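{- The graph $L(K_6)\times K_2$ is connected and total 8-uniform.
   Context: All graphs are finite and simple. $L(K_6)$ is the graph whose vertices are the 2-element subsets of $\{1,\dots,6\}$, two being adjacent iff they share an element. The direct product $G\times H$ has vertex set $V(G)\times V(H)$, with $(g,h)$ adjacent to $(g',h')$ iff $gg'\in E(G)$ and $hh'\in E(H)$. $N(v)$ is the set of neighbors of $v$. For a graph $G$ with no isolated vertices, a total dominating set is a set $A\subseteq V(G)$ such that every vertex of $G$ has a neighbor in $A$; $\gamma_t(G)$ is the minimum size of one. A sequence $(v_1,\dots,v_m)$ of distinct vertices is legal if $N(v_i)\setminus\bigcup_{j=1}^{i-1}N(v_j)\neq\emptyset$ for every $i\in\{2,\dots,m\}$; it is a total dominating sequence if moreover $\{v_1,\dots,v_m\}$ is a total dominating set. $\gamma_{gr}^t(G)$ is the maximum length of a total dominating sequence. $G$ is total $k$-uniform if $\gamma_t(G)=\gamma_{gr}^t(G)=k$. -}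

module Defs where

open import Data.Nat using (ℕ; _≤_; _≥_)
open import Data.Fin using (Fin; _<_)
open import Data.Product using (Σ; ∃; _×_; _,_; proj₁; proj₂)
open import Data.Sum using (_⊎_)
open import Data.Unit using (⊤)
open import Data.List using (List; []; _∷_; length)
open import Data.List.Membership.Propositional using (_∈_)
open import Data.List.Relation.Unary.All using (All)
open import Data.List.Relation.Unary.Any using (Any)
open import Data.List.Relation.Unary.Unique.Propositional using (Unique)
open import Relation.Nullary using (¬_)
open import Relation.Binary.PropositionalEquality using (_≡_; _≢_)

-- A graph: a vertex type with an adjacency relation.  All graphs used below
-- (K₂, L(K₆), and their direct product) are finite and simple
-- (adjacency symmetric and irreflexive) by construction.
record Graph : Set₁ where
  field
    V   : Set
    Adj : V → V → Set
open Graph public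

K₂ : Graph
K₂ = record { V = Fin 2 ; Adj = λ x y → x ≢ y }

-- L(K₆): vertices are 2-element subsets {a,b} of a 6-element set, represented
-- canonically as pairs (a , b) with a < b; two distinct such subsets are
-- adjacent iff they share an element.
Pair6 : Set
Pair6 = Σ (Fin 6 × Fin 6) (λ ab → proj₁ ab < proj₂ ab)

fst snd : Pair6 → Fin 6
fst p = proj₁ (proj₁ p)
snd p = proj₂ (proj₁ p)

ShareElement : Pair6 → Pair6 → Set
ShareElement p q =
  (fst p ≡ fst q) ⊎ (fst p ≡ snd q) ⊎ (snd p ≡ fst q) ⊎ (snd p ≡ snd q)

LK₆ : Graph
LK₆ = record { V = Pair6 ; Adj = λ p q → p ≢ q × ShareElement p q }

_×ᴳ_ : Graph → Graph → Graph
G ×ᴳ H = record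
  { V   = V G × V H
  ; Adj = λ x y → Adj G (proj₁ x) (proj₁ y) × Adj H (proj₂ x) (proj₂ y) }

module _ (G : Graph) where

  data Walk : V G → V G → Set where
    stay : ∀ {u} → Walk u u
    step : ∀ {u w v} → Adj G u w → Walk w v → Walk u v

  Connected : Set
  Connected = ∀ u v → Walk u v

  -- A set of vertices is represented by a duplicate-free list; its size is the
  -- length of the list.
  IsTotalDominating : List (V G) → Set
  IsTotalDominating A = ∀ v → Any (λ a → Adj G v a) A

  TDSet : List (V G) → Set
  TDSet A = Unique A × IsTotalDominating A

  γt≡ : ℕ → Set
  γt≡ k = (Σ (List (V G)) λ A → TDSet A × length A ≡ k)
        × (∀ A → TDSet A → k ≤ length A)

  -- Legality: each vertex after the first has a neighbour not in the
  -- neighbourhood of any earlier vertex.  `prev` holds the earlier vertices.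
  LegalFrom : List (V G) → List (V G) → Set
  LegalFrom prev []       = ⊤
  LegalFrom prev (v ∷ vs) =
    (Σ (V G) λ w → Adj G v w × All (λ u → ¬ Adj G u w) prev)
    × LegalFrom (v ∷ prev) vs

  Legal : List (V G) → Set
  Legal []       = ⊤
  Legal (v ∷ vs) = LegalFrom (v ∷ []) vs

  TDSequence : List (V G) → Set
  TDSequence S = Unique S × Legal S × IsTotalDominating S

  γgrt≡ : ℕ → Set
  γgrt≡ k = (Σ (List (V G)) λ S → TDSequence S × length S ≡ k)
          × (∀ S → TDSequence S → length S ≤ k)

  TotalUniform : ℕ → Set
  TotalUniform k = γt≡ k × γgrt≡ k

-- A total dominating set of G ×ᴳ K₂ splits into two layers, each of which totally
-- dominates G, and a legal sequence of G ×ᴳ K₂ splits into two legal sequences of G.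
-- Conversely a total dominating sequence S of G gives the sequence S × {0} followed
-- by S × {1}.  So γt and γgrt double, provided every legal sequence of G is at most
-- as long as a total dominating sequence.  For L(K₆) the star of four edges at a point
-- is a total dominating sequence, no three vertices totally dominate, and no legal
-- sequence has five terms; the last fact is checked exhaustively after relabelling the
-- points of K₆ so that the sequence starts with {0,1} followed by {0,2} or {2,3}.
-- Connectivity holds because L(K₆) is connected and contains a triangle, an odd
-- closed walk, whose lift switches the K₂-layer.

module Submission where

open import Data.Bool using (true)
open import Data.Empty using (⊥; ⊥-elim)
open import Data.Fin using (Fin; zero; suc; #_)
open import Data.Fin.Permutation.Components using (transpose)
open import Data.Fin.Properties using (<-cmp; <-irrelevant; _<?_) renaming (_≟_ to _≟ᶠ_)
open import Data.List using (List; []; _∷_; _++_; _ʳ++_; length; map; allFin; cartesianProduct)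
open import Data.List.Membership.Propositional using (_∈_; lose)
open import Data.List.Membership.Propositional.Properties using (∈-allFin; ∈-cartesianProduct⁺; ∈-map⁻)
open import Data.List.Properties using (length-++; length-map)
open import Data.List.Relation.Unary.All as All using (All; []; _∷_; all?)
import Data.List.Relation.Unary.All.Properties as AllP
open import Data.List.Relation.Unary.AllPairs using ([]; _∷_; allPairs?)
open import Data.List.Relation.Unary.Any as Any using (Any; here; there; any?)
import Data.List.Relation.Unary.Any.Properties as AnyP
open import Data.List.Relation.Unary.Unique.Propositional using (Unique)
import Data.List.Relation.Unary.Unique.Propositional.Properties as Unique
open import Data.Nat using (ℕ; zero; suc; _+_; _≤_; _<_; z≤n; s≤s)
open import Data.Nat.Properties using (≰⇒>; +-mono-≤; +-suc)
open import Data.Product using (Σ; _×_; _,_; proj₁; proj₂)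
open import Data.Product.Properties using (≡-dec)
open import Data.Sum using (_⊎_; inj₁; inj₂; [_,_]′)
open import Data.Unit using (tt)
open import Function using (_∘_; id)
open import Relation.Binary using (DecidableEquality; tri<; tri≈; tri>)
import Relation.Binary as B
open import Relation.Binary.PropositionalEquality
  using (_≡_; _≢_; refl; sym; trans; cong; cong₂; subst; subst₂; module ≡-Reasoning)
open import Relation.Nullary using (¬_; Dec; yes; no; ¬?; does)
open import Relation.Nullary.Decidable using (_×-dec_; _⊎-dec_; _→-dec_; map′; True; toWitness)
open import Relation.Unary using (Irrelevant)
import Relation.Unary as U
open import Defs

-- Checking `does a? ≡ true` by refl is much faster in Agda than the `T`-based from-yes.
decided : ∀ {A : Set} (a? : Dec A) → does a? ≡ true → A
decided (yes a) _ = a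

All-ʳ++ : ∀ {A : Set} {P : A → Set} {xs ys} → All P xs → All P ys → All P (xs ʳ++ ys)
All-ʳ++ []       qs = qs
All-ʳ++ (p ∷ ps) qs = All-ʳ++ ps (p ∷ qs)

filterΣ : ∀ {A : Set} {P : A → Set} → U.Decidable P → List A → List (Σ A P)
filterΣ P? []       = []
filterΣ P? (x ∷ xs) with P? x
... | yes p = (x , p) ∷ filterΣ P? xs
... | no  _ = filterΣ P? xs

∈-filterΣ : ∀ {A : Set} {P : A → Set} (P? : U.Decidable P) → Irrelevant P →
            ∀ {x p xs} → x ∈ xs → (x , p) ∈ filterΣ P? xs
∈-filterΣ P? irrelevant {p = p} {y ∷ _} (here refl) with P? y
... | yes q =  here (cong (y ,_) (irrelevant p q))
... | no ¬p = ⊥-elim (¬p p)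
∈-filterΣ P? irrelevant {xs = y ∷ _} (there x∈) with P? y
... | yes _ = there (∈-filterΣ P? irrelevant x∈)
... | no  _ = ∈-filterΣ P? irrelevant x∈

-- Legal sequences and total domination in a graph

module _ (G : Graph) where

  Undominated : List (V G) → V G → Set
  Undominated P w = All (λ u → ¬ Adj G u w) P

  NewNeighbour : List (V G) → V G → Set
  NewNeighbour P v = Σ (V G) λ w → Adj G v w × Undominated P w

  -- The first disjunct implies the second, but is far cheaper to decide.
  ContinuationsShorterThan : ℕ → List (V G) → Set
  ContinuationsShorterThan zero    P = ⊥
  ContinuationsShorterThan (suc n) P =
    (∀ w → ¬ Undominated P w) ⊎ (∀ v → ¬ NewNeighbour P v ⊎ ContinuationsShorterThan n (v ∷ P))

  NoDominatingExtension : ℕ → List (V G) → Set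
  NoDominatingExtension zero    S = ¬ IsTotalDominating G S
  NoDominatingExtension (suc n) S =
    ¬ IsTotalDominating G S × (∀ v → NoDominatingExtension n (v ∷ S))

  ReachableWithin : ℕ → V G → V G → Set
  ReachableWithin zero    u v = u ≡ v
  ReachableWithin (suc n) u v = u ≡ v ⊎ Σ (V G) λ w → Adj G u w × ReachableWithin n w v

module _ {G : Graph} where

  ¬newNeighbour-self : ∀ {v P} → ¬ NewNeighbour G (v ∷ P) v
  ¬newNeighbour-self (_ , v~w , ¬v~w ∷ _) = ¬v~w v~w

  legalFrom-length : ∀ {n P} vs → ContinuationsShorterThan G n P → LegalFrom G P vs → length vs < n
  legalFrom-length {suc n} []       _     _            = s≤s z≤n
  legalFrom-length {suc n} (v ∷ vs) (inj₁ dominated) ((w , _ , undominated) , _) =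
    ⊥-elim (dominated w undominated)
  legalFrom-length {suc n} (v ∷ vs) (inj₂ short) (new , rest) with short v
  ... | inj₁ ¬new  = ⊥-elim (¬new new)
  ... | inj₂ short′ = s≤s (legalFrom-length vs short′ rest)

  noDominatingExtension⇒¬dominating : ∀ {n S} → NoDominatingExtension G n S → ¬ IsTotalDominating G S
  noDominatingExtension⇒¬dominating {zero}  none       = none
  noDominatingExtension⇒¬dominating {suc n} (none , _) = none

  noDominatingExtension-length : ∀ {n S} A → NoDominatingExtension G n S → length A ≤ n →
                                 ¬ (∀ v → Any (Adj G v) A ⊎ Any (Adj G v) S)
  noDominatingExtension-length [] none _ dom =
    noDominatingExtension⇒¬dominating none (λ v → [ (λ ()) , id ]′ (dom v))
  noDominatingExtension-length {suc n} (x ∷ A) (_ , extend) (s≤s len) dom =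
    noDominatingExtension-length A (extend x) len (move ∘ dom)
    where
    move : ∀ {v} → Any (Adj G v) (x ∷ A) ⊎ Any (Adj G v) _ → Any (Adj G v) A ⊎ Any (Adj G v) (x ∷ _)
    move (inj₁ (here a))  = inj₂ (here a)
    move (inj₁ (there a)) = inj₁ a
    move (inj₂ a)         = inj₂ (there a)

  totalDominating-length : ∀ {n A} → NoDominatingExtension G n [] → IsTotalDominating G A → n < length A
  totalDominating-length {A = A} none dom =
    ≰⇒> (λ len → noDominatingExtension-length A none len (inj₁ ∘ dom))

  reachableWithin⇒walk : ∀ {n u v} → ReachableWithin G n u v → Walk G u v
  reachableWithin⇒walk {zero}  refl                  = stay
  reachableWithin⇒walk {suc n} (inj₁ refl)           = stay
  reachableWithin⇒walk {suc n} (inj₂ (w , a , reach)) = step a (reachableWithin⇒walk reach)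

  legalFrom-++ : ∀ {Q} as {bs} → LegalFrom G Q as → LegalFrom G (as ʳ++ Q) bs → LegalFrom G Q (as ++ bs)
  legalFrom-++ []       _            legal = legal
  legalFrom-++ (a ∷ as) (new , rest) legal = new , legalFrom-++ as rest legal

  legalFrom-[]⇒legal : ∀ vs → LegalFrom G [] vs → Legal G vs
  legalFrom-[]⇒legal []       _          = tt
  legalFrom-[]⇒legal (v ∷ vs) (_ , rest) = rest

IsEmbedding : (G H : Graph) → (V G → V H) → Set
IsEmbedding G H f = ∀ u w → (Adj G u w → Adj H (f u) (f w)) × (Adj H (f u) (f w) → Adj G u w)

∘-isEmbedding : ∀ {G H K} {g : V H → V K} {f : V G → V H} →
                IsEmbedding H K g → IsEmbedding G H f → IsEmbedding G K (g ∘ f)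
∘-isEmbedding g-emb f-emb u w =
  proj₁ (g-emb _ _) ∘ proj₁ (f-emb u w) , proj₂ (f-emb u w) ∘ proj₂ (g-emb _ _)

module _ {G H : Graph} {f : V G → V H} (embedding : IsEmbedding G H f) where

  newNeighbour-map : ∀ {P v} → NewNeighbour G P v → NewNeighbour H (map f P) (f v)
  newNeighbour-map {P} (w , v~w , undominated) = f w , proj₁ (embedding _ w) v~w , reflect P undominated
    where
    reflect : ∀ P → Undominated G P w → Undominated H (map f P) (f w)
    reflect []      []          = []
    reflect (u ∷ P) (¬u~w ∷ ¬P) = ¬u~w ∘ proj₂ (embedding u w) ∷ reflect P ¬P

  legalFrom-map : ∀ {P} vs → LegalFrom G P vs → LegalFrom H (map f P) (map f vs)
  legalFrom-map []       _            = tt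
  legalFrom-map (v ∷ vs) (new , rest) = newNeighbour-map new , legalFrom-map vs rest

legal-length-from-starts :
  ∀ {G n} (starts : List (V G × V G)) →
  All (λ (r₁ , r₂) → ContinuationsShorterThan G n (r₂ ∷ r₁ ∷ [])) starts →
  (∀ v₁ v₂ → NewNeighbour G (v₁ ∷ []) v₂ →
     Σ (V G → V G) λ f → IsEmbedding G G f × (f v₁ , f v₂) ∈ starts) →
  ∀ S → Legal G S → length S ≤ suc n
legal-length-from-starts starts short normalise []            _            = z≤n
legal-length-from-starts starts short normalise (v ∷ [])      _            = s≤s z≤n
legal-length-from-starts starts short normalise (v₁ ∷ v₂ ∷ vs) (new , rest) with normalise v₁ v₂ new
... | f , embedding , f-start∈ =
  s≤s (subst (_< _) (length-map f vs)
                (legalFrom-length (map f vs) (All.lookup short f-start∈) (legalFrom-map embedding vs rest)))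

-- Deciding these notions in a finite graph

module Finite (G : Graph) (vertices : List (V G)) (∈-vertices : ∀ v → v ∈ vertices)
              (_≟_ : DecidableEquality (V G)) (adj? : B.Decidable (Adj G)) where

  ∀? : {P : V G → Set} → U.Decidable P → Dec (∀ v → P v)
  ∀? P? = map′ (λ all v → All.lookup all (∈-vertices v)) (λ all → All.tabulate λ {v} _ → all v)
               (all? P? vertices)

  ∃? : {P : V G → Set} → U.Decidable P → Dec (Σ (V G) P)
  ∃? P? = map′ Any.satisfied (λ (v , p) → lose (∈-vertices v) p) (any? P? vertices)

  undominated? : ∀ P w → Dec (Undominated G P w)
  undominated? P w = all? (λ u → ¬? (adj? u w)) P

  newNeighbour? : ∀ P v → Dec (NewNeighbour G P v)
  newNeighbour? P v = ∃? λ w → adj? v w ×-dec undominated? P w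

  isTotalDominating? : ∀ A → Dec (IsTotalDominating G A)
  isTotalDominating? A = ∀? λ v → any? (adj? v) A

  legalFrom? : ∀ P vs → Dec (LegalFrom G P vs)
  legalFrom? P []       = yes tt
  legalFrom? P (v ∷ vs) = newNeighbour? P v ×-dec legalFrom? (v ∷ P) vs

  legal? : ∀ S → Dec (Legal G S)
  legal? []       = yes tt
  legal? (v ∷ vs) = legalFrom? (v ∷ []) vs

  tdSequence? : ∀ S → Dec (TDSequence G S)
  tdSequence? S = allPairs? (λ x y → ¬? (x ≟ y)) S ×-dec legal? S ×-dec isTotalDominating? S

  continuationsShorterThan? : ∀ n P → Dec (ContinuationsShorterThan G n P)
  continuationsShorterThan? zero    P = no id
  continuationsShorterThan? (suc n) P = (∀? λ w → ¬? (undominated? P w)) ⊎-dec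
    ∀? λ v → ¬? (newNeighbour? P v) ⊎-dec continuationsShorterThan? n (v ∷ P)

  noDominatingExtension? : ∀ n S → Dec (NoDominatingExtension G n S)
  noDominatingExtension? zero    S = ¬? (isTotalDominating? S)
  noDominatingExtension? (suc n) S =
    ¬? (isTotalDominating? S) ×-dec ∀? λ v → noDominatingExtension? n (v ∷ S)

  reachableWithin? : ∀ n u v → Dec (ReachableWithin G n u v)
  reachableWithin? zero    u v = u ≟ v
  reachableWithin? (suc n) u v = (u ≟ v) ⊎-dec ∃? λ w → adj? u w ×-dec reachableWithin? n w v

  isEmbedding? : ∀ f → Dec (IsEmbedding G G f)
  isEmbedding? f = ∀? λ u → ∀? λ w →
    (adj? u w →-dec adj? (f u) (f w)) ×-dec (adj? (f u) (f w) →-dec adj? u w)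

-- The direct product with K₂

flip : Fin 2 → Fin 2
flip zero    = suc zero
flip (suc _) = zero

≢-flip : ∀ i → i ≢ flip i
≢-flip zero       ()
≢-flip (suc zero) ()

≡⊎≡-flip : ∀ i j → j ≡ i ⊎ j ≡ flip i
≡⊎≡-flip zero       zero       = inj₁ refl
≡⊎≡-flip zero       (suc zero) = inj₂ refl
≡⊎≡-flip (suc zero) zero       = inj₂ refl
≡⊎≡-flip (suc zero) (suc zero) = inj₁ refl

≢⇒≡-flip : ∀ {i j} → i ≢ j → j ≡ flip i
≢⇒≡-flip {i} {j} i≢j with ≡⊎≡-flip i j
... | inj₁ j≡i      = ⊥-elim (i≢j (sym j≡i))
... | inj₂ j≡flip-i = j≡flip-i

flip-≢⇒≡ : ∀ {i j} → flip i ≢ j → j ≡ i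
flip-≢⇒≡ {i} {j} flip-i≢j with ≡⊎≡-flip i j
... | inj₁ j≡i      = j≡i
... | inj₂ j≡flip-i = ⊥-elim (flip-i≢j (sym j≡flip-i))

module _ {G : Graph} where

  _◅◅_ : ∀ {u v w} → Walk G u v → Walk G v w → Walk G u w
  stay     ◅◅ w′ = w′
  step a w ◅◅ w′ = step a (w ◅◅ w′)

  endLayer : ∀ {u v} → Walk G u v → Fin 2 → Fin 2
  endLayer stay       i = i
  endLayer (step _ w) i = endLayer w (flip i)

  lift : ∀ {u v} (w : Walk G u v) i → Walk (G ×ᴳ K₂) (u , i) (v , endLayer w i)
  lift stay       i = stay
  lift (step a w) i = step (a , ≢-flip i) (lift w (flip i))

  endLayer-flip : ∀ {u v} (w : Walk G u v) i → endLayer w (flip i) ≡ flip (endLayer w i)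
  endLayer-flip stay       i = refl
  endLayer-flip (step _ w) i = endLayer-flip w (flip i)

  endLayer-◅◅ : ∀ {u v x} (w : Walk G u v) (w′ : Walk G v x) i →
                endLayer (w ◅◅ w′) i ≡ endLayer w′ (endLayer w i)
  endLayer-◅◅ stay       w′ i = refl
  endLayer-◅◅ (step _ w) w′ i = endLayer-◅◅ w w′ (flip i)

  Odd : ∀ {u v} → Walk G u v → Set
  Odd w = endLayer w zero ≡ suc zero

  odd-endLayer : ∀ {u v} (w : Walk G u v) → Odd w → ∀ i → endLayer w i ≡ flip i
  odd-endLayer w odd zero       = odd
  odd-endLayer w odd (suc zero) = trans (endLayer-flip w zero) (cong flip odd)

connected-×K₂ : ∀ G → Connected G → ∀ {c} (w : Walk G c c) → Odd w → Connected (G ×ᴳ K₂)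
connected-×K₂ G connected cycle odd (a , i) (b , j) = reach (≡⊎≡-flip (endLayer direct i) j)
  where
  out    = connected a _
  back   = connected _ a ◅◅ connected a b
  direct = out ◅◅ back
  detour = out ◅◅ (cycle ◅◅ back)
  open ≡-Reasoning
  detour-flips : endLayer detour i ≡ flip (endLayer direct i)
  detour-flips = begin
    endLayer detour i                               ≡⟨ endLayer-◅◅ out _ i ⟩
    endLayer (cycle ◅◅ back) (endLayer out i)       ≡⟨ endLayer-◅◅ cycle back _ ⟩
    endLayer back (endLayer cycle (endLayer out i)) ≡⟨ cong (endLayer back) (odd-endLayer cycle odd _) ⟩
    endLayer back (flip (endLayer out i))           ≡⟨ endLayer-flip back _ ⟩
    flip (endLayer back (endLayer out i))           ≡⟨ cong flip (endLayer-◅◅ out back i) ⟨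
    flip (endLayer direct i)                        ∎
  reach : j ≡ endLayer direct i ⊎ j ≡ flip (endLayer direct i) → Walk (G ×ᴳ K₂) (a , i) (b , j)
  reach (inj₁ refl) = lift direct i
  reach (inj₂ refl) = subst (λ k → Walk (G ×ᴳ K₂) (a , i) (b , k)) detour-flips (lift detour i)

module _ {G : Graph} where

  layer : Fin 2 → List (V G × Fin 2) → List (V G)
  layer i []             = []
  layer i ((v , j) ∷ xs) with j ≟ᶠ i
  ... | yes _ = v ∷ layer i xs
  ... | no  _ = layer i xs

  length-layers : ∀ xs → length (layer zero xs) + length (layer (suc zero) xs) ≡ length xs
  length-layers []                    = refl
  length-layers ((v , zero)     ∷ xs) = cong suc (length-layers xs)
  length-layers ((v , suc zero) ∷ xs) = trans (+-suc _ _) (cong suc (length-layers xs))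

  Any-layer : ∀ {P : V G → Set} {i} xs →
              Any (λ x → P (proj₁ x) × proj₂ x ≡ i) xs → Any P (layer i xs)
  Any-layer {i = i} ((v , j) ∷ xs) any with j ≟ᶠ i | any
  ... | yes _   | here (p , _)   = here p
  ... | yes _   | there any′     = there (Any-layer xs any′)
  ... | no j≢i  | here (_ , j≡i) = ⊥-elim (j≢i j≡i)
  ... | no _    | there any′     = Any-layer xs any′

  All-layer : ∀ {P : V G → Set} {i} xs →
              All (λ x → proj₂ x ≡ i → P (proj₁ x)) xs → All P (layer i xs)
  All-layer {i = i} []             []         = []
  All-layer {i = i} ((v , j) ∷ xs) (p ∷ ps) with j ≟ᶠ i
  ... | yes j≡i = p j≡i ∷ All-layer xs ps
  ... | no  _   = All-layer xs ps

  unique-layer : ∀ i {xs} → Unique xs → Unique (layer i xs)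
  unique-layer i {[]}           []         = []
  unique-layer i {(v , j) ∷ xs} (v∉ ∷ uniq) with j ≟ᶠ i
  ... | yes refl =
    All-layer xs (All.map (λ v≢ l≡i v≡u → v≢ (cong₂ _,_ v≡u (sym l≡i))) v∉) ∷ unique-layer i uniq
  ... | no  _    = unique-layer i uniq

  dominating-layer : ∀ i {A} → IsTotalDominating (G ×ᴳ K₂) A → IsTotalDominating G (layer i A)
  dominating-layer i {A} dom v =
    Any-layer A (Any.map (λ (v~a , flip-i≢j) → v~a , flip-≢⇒≡ flip-i≢j) (dom (v , flip i)))

  reflect-∷ : ∀ {i P Q v} → (∀ w → Undominated (G ×ᴳ K₂) Q (w , flip i) → Undominated G P w) →
              ∀ w → Undominated (G ×ᴳ K₂) ((v , i) ∷ Q) (w , flip i) → Undominated G (v ∷ P) w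
  reflect-∷ {i} reflect w (¬v~w ∷ undominated) = (λ v~w → ¬v~w (v~w , ≢-flip i)) ∷ reflect w undominated

  legalFrom-layer : ∀ i {P Q} vs → (∀ w → Undominated (G ×ᴳ K₂) Q (w , flip i) → Undominated G P w) →
                    LegalFrom (G ×ᴳ K₂) Q vs → LegalFrom G P (layer i vs)
  legalFrom-layer i []             _       _ = tt
  legalFrom-layer i ((v , j) ∷ vs) reflect (((w , k) , (v~w , j≢k) , undominated) , rest) with j ≟ᶠ i
  ... | yes refl =
    (w , v~w , reflect w (subst (λ l → Undominated (G ×ᴳ K₂) _ (w , l)) (≢⇒≡-flip j≢k) undominated)) ,
    legalFrom-layer i vs (reflect-∷ reflect) rest
  ... | no  _    = legalFrom-layer i vs (λ w → reflect w ∘ All.tail) rest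

  legal-layer : ∀ i S → Legal (G ×ᴳ K₂) S → Legal G (layer i S)
  legal-layer i []             _     = tt
  legal-layer i ((v , j) ∷ vs) legal with j ≟ᶠ i
  ... | yes refl = legalFrom-layer i vs (reflect-∷ λ _ _ → []) legal
  ... | no  _    = legalFrom-[]⇒legal (layer i vs) (legalFrom-layer i vs (λ _ _ → []) legal)

  double : List (V G) → List (V G × Fin 2)
  double S = map (_, zero) S ++ map (_, suc zero) S

  length-double : ∀ S → length (double S) ≡ length S + length S
  length-double S = trans (length-++ (map (_, zero) S)) (cong₂ _+_ (length-map _ S) (length-map _ S))

  unique-double : ∀ {S} → Unique S → Unique (double S)
  unique-double unique =
    Unique.++⁺ (Unique.map⁺ (cong proj₁) unique) (Unique.map⁺ (cong proj₁) unique) disjoint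
    where
    disjoint : ∀ {x} → ¬ (x ∈ map (_, zero) _ × x ∈ map (_, suc zero) _)
    disjoint (x∈₀ , x∈₁) with ∈-map⁻ (_, zero) x∈₀ | ∈-map⁻ (_, suc zero) x∈₁
    ... | _ , _ , refl | _ , _ , ()

  dominating-double : ∀ {S} → IsTotalDominating G S → IsTotalDominating (G ×ᴳ K₂) (double S)
  dominating-double {S} dom (v , zero)     =
    AnyP.++⁺ʳ (map (_, zero) S) (AnyP.map⁺ (Any.map (_, λ ()) (dom v)))
  dominating-double {S} dom (v , suc zero) = AnyP.++⁺ˡ (AnyP.map⁺ (Any.map (_, λ ()) (dom v)))

  hide-∷ : ∀ {i P Q v} → (∀ w → Undominated G P w → Undominated (G ×ᴳ K₂) Q (w , flip i)) →
           ∀ w → Undominated G (v ∷ P) w → Undominated (G ×ᴳ K₂) ((v , i) ∷ Q) (w , flip i)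
  hide-∷ hide w (¬v~w ∷ undominated) = ¬v~w ∘ proj₁ ∷ hide w undominated

  legalFrom-lift : ∀ i {P Q} vs → (∀ w → Undominated G P w → Undominated (G ×ᴳ K₂) Q (w , flip i)) →
                   LegalFrom G P vs → LegalFrom (G ×ᴳ K₂) Q (map (_, i) vs)
  legalFrom-lift i []       _    _                                 = tt
  legalFrom-lift i (v ∷ vs) hide ((w , v~w , undominated) , rest) =
    ((w , flip i) , (v~w , ≢-flip i) , hide w undominated) , legalFrom-lift i vs (hide-∷ hide) rest

  legal-double : ∀ {S} → IsTotalDominating G S → Legal G S → Legal (G ×ᴳ K₂) (double S)
  legal-double {[]}     _   _     = tt
  legal-double {x ∷ xs} dom legal = legalFrom-++ (map (_, zero) xs) first second
    where
    first : LegalFrom (G ×ᴳ K₂) ((x , zero) ∷ []) (map (_, zero) xs)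
    first = legalFrom-lift zero xs (hide-∷ λ _ _ → []) legal
    onLayer₀ : All (λ q → proj₂ q ≡ zero) (map (_, zero) xs ʳ++ ((x , zero) ∷ []))
    onLayer₀ = All-ʳ++ (AllP.map⁺ (All.universal (λ _ → refl) xs)) (refl ∷ [])
    x-new : NewNeighbour G [] x
    x-new = let (w , x~w) = Any.satisfied (dom x) in w , x~w , []
    -- The earlier terms all lie in layer 0, so they dominate nothing in layer 0.
    second : LegalFrom (G ×ᴳ K₂) (map (_, zero) xs ʳ++ ((x , zero) ∷ [])) (map (_, suc zero) (x ∷ xs))
    second = legalFrom-lift (suc zero) (x ∷ xs) (λ w _ → All.map (λ l≡0 (_ , l≢0) → l≢0 l≡0) onLayer₀)
                            (x-new , legal)

  γt-×K₂ : ∀ {k} → γt≡ G k → γt≡ (G ×ᴳ K₂) (k + k)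
  γt-×K₂ ((A , (unique , dom) , refl) , minimal) =
    (double A , (unique-double unique , dominating-double dom) , length-double A) ,
    λ B (uniqueB , domB) → subst (length A + length A ≤_) (length-layers B)
      (+-mono-≤ (minimal _ (unique-layer zero uniqueB , dominating-layer zero domB))
                (minimal _ (unique-layer (suc zero) uniqueB , dominating-layer (suc zero) domB)))

  γgrt-×K₂ : ∀ {k} → (Σ (List (V G)) λ S → TDSequence G S × length S ≡ k) →
             (∀ S → Legal G S → length S ≤ k) → γgrt≡ (G ×ᴳ K₂) (k + k)
  γgrt-×K₂ (S , (unique , legal , dom) , refl) bounded =
    (double S , (unique-double unique , legal-double dom legal , dominating-double dom) , length-double S) ,
    λ T (_ , legalT , _) → subst (_≤ length S + length S) (length-layers T)
      (+-mono-≤ (bounded (layer zero T) (legal-layer zero T legalT))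
                (bounded (layer (suc zero) T) (legal-layer (suc zero) T legalT)))

-- The line graph of K₆

edge : (a b : Fin 6) {a<b : True (a <? b)} → Pair6
edge a b {a<b} = (a , b) , toWitness a<b

edges : List Pair6
edges = filterΣ (λ (a , b) → a <? b) (cartesianProduct (allFin 6) (allFin 6))

∈-edges : ∀ p → p ∈ edges
∈-edges ((a , b) , _) =
  ∈-filterΣ (λ (a , b) → a <? b) (λ _ _ → <-irrelevant _ _) (∈-cartesianProduct⁺ (∈-allFin a) (∈-allFin b))

_≟ᵉ_ : DecidableEquality Pair6
_≟ᵉ_ = ≡-dec (≡-dec _≟ᶠ_ _≟ᶠ_) (λ p q → yes (<-irrelevant p q))

shareElement? : B.Decidable ShareElement
shareElement? p q =
  (fst p ≟ᶠ fst q) ⊎-dec (fst p ≟ᶠ snd q) ⊎-dec (snd p ≟ᶠ fst q) ⊎-dec (snd p ≟ᶠ snd q)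

adj? : B.Decidable (Adj LK₆)
adj? p q = ¬? (p ≟ᵉ q) ×-dec shareElement? p q

open Finite LK₆ edges ∈-edges _≟ᵉ_ adj?

e₀₁ e₀₂ e₁₂ e₂₃ : Pair6
e₀₁ = edge (# 0) (# 1)
e₀₂ = edge (# 0) (# 2)
e₁₂ = edge (# 1) (# 2)
e₂₃ = edge (# 2) (# 3)

-- The value at i ≡ j is junk; below span is only applied to images of distinct points
-- under permutations.
span : Fin 6 → Fin 6 → Pair6
span i j with <-cmp i j
... | tri< i<j _ _ = (i , j) , i<j
... | tri≈ _ _ _   = e₀₁
... | tri> _ _ j<i = (j , i) , j<i

-- Abstract, so that normalise-start uses the checked facts without unfolding the
-- relabellings during unification.
abstract
  relabel : (Fin 6 → Fin 6) → Pair6 → Pair6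
  relabel π p = span (π (fst p)) (π (snd p))

  toStart : Pair6 → Fin 6 → Fin 6
  toStart p = transpose (# 1) (transpose (# 0) (fst p) (snd p)) ∘ transpose (# 0) (fst p)

  toSecond : Pair6 → Fin 6 → Fin 6
  toSecond q with shareElement? q e₀₁
  ... | yes _ = transpose (# 2) (snd q) ∘ transpose (# 0) (fst q)
  ... | no  _ = transpose (# 3) (transpose (# 2) (fst q) (snd q)) ∘ transpose (# 2) (fst q)

  toStart-normalises : ∀ p → relabel (toStart p) p ≡ e₀₁ × IsEmbedding LK₆ LK₆ (relabel (toStart p))
  toStart-normalises =
    decided (∀? λ p → (relabel (toStart p) p ≟ᵉ e₀₁) ×-dec isEmbedding? (relabel (toStart p))) refl

  toSecond-normalises : ∀ q → q ≡ e₀₁ ⊎ relabel (toSecond q) e₀₁ ≡ e₀₁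
                                      × (relabel (toSecond q) q ≡ e₀₂ ⊎ relabel (toSecond q) q ≡ e₂₃)
                                      × IsEmbedding LK₆ LK₆ (relabel (toSecond q))
  toSecond-normalises = decided (∀? λ q → let g = relabel (toSecond q) in
    (q ≟ᵉ e₀₁) ⊎-dec (g e₀₁ ≟ᵉ e₀₁) ×-dec (g q ≟ᵉ e₀₂ ⊎-dec g q ≟ᵉ e₂₃) ×-dec isEmbedding? g) refl

starts : List (Pair6 × Pair6)
starts = (e₀₁ , e₀₂) ∷ (e₀₁ , e₂₃) ∷ []

normalise-start : ∀ v₁ v₂ → NewNeighbour LK₆ (v₁ ∷ []) v₂ →
                  Σ (Pair6 → Pair6) λ f → IsEmbedding LK₆ LK₆ f × (f v₁ , f v₂) ∈ starts
normalise-start v₁ v₂ new with toStart-normalises v₁ | toSecond-normalises (relabel (toStart v₁) v₂)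
... | h-v₁ , h-emb | inj₁ h-v₂ =
  ⊥-elim (¬newNeighbour-self
    (subst₂ (λ a b → NewNeighbour LK₆ (a ∷ []) b) h-v₁ h-v₂ (newNeighbour-map h-emb new)))
... | h-v₁ , h-emb | inj₂ (g-e₀₁ , g-h-v₂ , g-emb) =
  g ∘ h , ∘-isEmbedding {LK₆} {LK₆} {LK₆} g-emb h-emb , start∈ g-h-v₂
  where
  h = relabel (toStart v₁)
  g = relabel (toSecond (h v₂))
  g-h-v₁ : g (h v₁) ≡ e₀₁
  g-h-v₁ = trans (cong g h-v₁) g-e₀₁
  start∈ : g (h v₂) ≡ e₀₂ ⊎ g (h v₂) ≡ e₂₃ → (g (h v₁) , g (h v₂)) ∈ starts
  start∈ (inj₁ ≡e₀₂) = here (cong₂ _,_ g-h-v₁ ≡e₀₂)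
  start∈ (inj₂ ≡e₂₃) = there (here (cong₂ _,_ g-h-v₁ ≡e₂₃))

legal-length-LK₆ : ∀ S → Legal LK₆ S → length S ≤ 4
legal-length-LK₆ = legal-length-from-starts starts
  (decided (all? (λ (r₁ , r₂) → continuationsShorterThan? 3 (r₂ ∷ r₁ ∷ [])) starts) refl) normalise-start

star : List Pair6
star = edge (# 0) (# 1) ∷ edge (# 0) (# 2) ∷ edge (# 0) (# 3) ∷ edge (# 0) (# 4) ∷ []

star-tdSequence : TDSequence LK₆ star
star-tdSequence = decided (tdSequence? star) refl

γt-LK₆ : γt≡ LK₆ 4
γt-LK₆ = (star , (proj₁ star-tdSequence , proj₂ (proj₂ star-tdSequence)) , refl) ,
         λ A (_ , dom) → totalDominating-length (decided (noDominatingExtension? 3 []) refl) dom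

triangle : Walk LK₆ e₀₁ e₀₁
triangle =
  step (decided (adj? e₀₁ e₀₂) refl) (step (decided (adj? e₀₂ e₁₂) refl) (step (decided (adj? e₁₂ e₀₁) refl) stay))

connected-LK₆ : Connected LK₆
connected-LK₆ u v = reachableWithin⇒walk (decided (∀? λ u → ∀? λ v → reachableWithin? 2 u v) refl u v)

corollary3p6 : Connected (LK₆ ×ᴳ K₂) × TotalUniform (LK₆ ×ᴳ K₂) 8
corollary3p6 = connected-×K₂ LK₆ connected-LK₆ triangle refl
             , γt-×K₂ γt-LK₆
             , γgrt-×K₂ (star , star-tdSequence , refl) legal-length-LK₆
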